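{- Let $\Vdash$ be a multiple-conclusion logic, let $\mathbb{M}=\langle A,\cdot_{\mathbb{M}},D\rangle$ be a $\Sigma$-Nmatrix and let $\mathcal{M}$ be a class of $\Sigma$-Nmatrices. (1) If $\mathbb{M}\in\mathsf{Nmatr}(\Vdash)$ and $v\in\mathrm{Val}(\mathbb{M})$, then $\mathbb{L}_v\in\mathcal{L}_{\Vdash}$. (2) $\mathcal{L}_{\Vdash_{\mathcal{M}}}=\{\mathbb{L}_v : v\in\mathrm{Val}(\mathbb{N}),\ \mathbb{N}\in\mathcal{M}\}\subseteq \mathsf{Hom}^{ -1}_s(\mathsf{S}(\mathcal{M}))$.
   Context: Fix a countable signature $\Sigma$ (sets $\Sigma^k$ of $k$-ary connectives, $k<\omega$), a denumerable set $P$ of propositional variables, and let $Fm$ be the set of formulas over $\Sigma$ and $P$; $\mathbf{Fm}$ is the absolutely free $\Sigma$-algebra on $Fm$, viewed as a multialgebra with $\copyright_{\mathbf{Fm}}(\varphi_1,\dots,\varphi_k)=\{\copyright(\varphi_1,\dots,\varphi_k)\}$ (its operations are denoted $\cdot_{\mathbf{Fm}}$). A substitution is a map $\sigma:P\to Fm$ extended homomorphically to $Fm$. A multiple-conclusion logic is a relation $\Vdash\subseteq\wp(Fm)\times\wp(Fm)$ such that for all $\Gamma,\Delta,\Gamma',\Delta'\subseteq Fm$: (O) if $\Gamma\cap\Delta\neq\emptyset$ then $\Gamma\Vdash\Delta$; (D) if $\Gamma\Vdash\Delta$ then $\Gamma\cup\Gamma'\Vdash\Delta\cup\Delta'$; (C)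 if $\Gamma\cup\Omega\Vdash (Fm\setminus\Omega)\cup\Delta$ for every $\Omega\subseteq Fm$ then $\Gamma\Vdash\Delta$; (S) if $\Gamma\Vdash\Delta$ then $\sigma[\Gamma]\Vdash\sigma[\Delta]$ for every substitution $\sigma$. A $\Sigma$-multialgebra $\langle A,\cdot_A\rangle$ assigns to each $\copyright\in\Sigma^k$ a function $\copyright_A:A^k\to\wp(A)\setminus\{\emptyset\}$. A $\Sigma$-Nmatrix is $\mathbb{M}=\langle A,\cdot_{\mathbb{M}},D\rangle$ with $\langle A,\cdot_{\mathbb{M}}\rangle$ a $\Sigma$-multialgebra and $D\subseteq A$ (designated elements). A valuation on $\mathbb{M}$ is a map $v:Fm\to A$ with $v(\copyright(\varphi_1,\dots,\varphi_k))\in\copyright_{\mathbb{M}}(v(\varphi_1),\dots,v(\varphi_k))$ for all $\copyright\in\Sigma^k$ and formulas $\varphi_i$; $\mathrm{Val}(\mathbb{M})$ is the set of valuations. $\mathbb{M}$ induces the logic $\Vdash_{\mathbb{M}}$: $\Gamma\Vdash_{\mathbb{M}}\Delta$ iff every $v\in\mathrm{Val}(\mathbb{M})$ with $v[\Gamma]\subseteq D$ satisfies $v[\Delta]\cap D\neq\emptyset$. For a class $\mathcal{M}$ of Nmatrices, $\Vdash_{\mathcal{M}}=\bigcap_{\mathbb{M}\in\mathcal{M}}\Vdash_{\mathbb{M}}$. Given a logic $\Vdash$, an Nmatrix $\mathbb{M}$ is $\Vdash$-sound if $\Vdash\subseteq\Vdash_{\mathbb{M}}$; $\mathsf{Nmatr}(\Vdash)$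 is the class of all $\Vdash$-sound $\Sigma$-Nmatrices. For $\Sigma$-Nmatrices $\mathbb{M}_1=\langle A_1,\cdot_1,D_1\rangle$, $\mathbb{M}_2=\langle A_2,\cdot_2,D_2\rangle$, a homomorphism $h:\mathbb{M}_1\to\mathbb{M}_2$ is a map $h:A_1\to A_2$ with $h[\copyright_1(a_1,\dots,a_k)]\subseteq\copyright_2(h(a_1),\dots,h(a_k))$ for all $\copyright\in\Sigma^k$, $a_i\in A_1$, and $h[D_1]\subseteq D_2$; it is strict if $h^{ -1}[D_2]=D_1$. An isomorphism is a bijective strict homomorphism with $h[\copyright_1(x_1,\dots,x_k)]=\copyright_2(h(x_1),\dots,h(x_k))$ for all arguments. The image of $\mathbb{M}_1$ under a strict homomorphism $h$ is $h[\mathbb{M}_1]=\langle h[A_1],\cdot_h,D_2\cap h[A_1]\rangle$ with $\copyright_h(x_1,\dots,x_k)=\{h(y): y\in\copyright_1(y_1,\dots,y_k),\ h(y_i)=x_i\ (1\le i\le k)\}$; $h$ is covering if $h[\mathbb{M}_1]=\mathbb{M}_2$. $\mathbb{M}_1$ is a subNmatrix of $\mathbb{M}_2$ if $A_1\subseteq A_2$ and $\copyright_1(x_1,\dots,x_k)\subseteq\copyright_2(x_1,\dots,x_k)$ for all $\copyright\in\Sigma^k$, $x_i\in A_1$. For a class $\mathcal{M}$: $\mathsf{S}(\mathcal{M})$ is the class of isomorphic copies of subNmatrices of members of $\mathcal{M}$; $\mathsf{Hom}^{ -1}_s(\mathcal{M})$ is the class of isomorphic copies of Nmatrices admitting a covering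 strict homomorphism onto a member of $\mathcal{M}$ (preimages by strict homomorphisms). The set of Lindenbaum matrices of a logic $\Vdash$ is $\mathcal{L}_{\Vdash}=\{\langle Fm,\cdot_{\mathbf{Fm}},\Gamma\rangle:\Gamma\not\Vdash Fm\setminus\Gamma\}$. For $v\in\mathrm{Val}(\mathbb{M})$ with $\mathbb{M}=\langle A,\cdot_{\mathbb{M}},D\rangle$, $\mathbb{L}_v=\langle Fm,\cdot_{\mathbf{Fm}},v^{ -1}[D]\rangle$. -}

module Defs where

open import Level using (Level; _⊔_) renaming (suc to lsuc; zero to lzero)
open import Data.Nat using (ℕ)
open import Data.Vec using (Vec; []; _∷_; map)
open import Data.Product using (Σ; ∃; _×_; _,_)
open import Data.Sum using (_⊎_)
open import Relation.Nullary using (¬_)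
open import Relation.Binary.PropositionalEquality using (_≡_; refl)
open import Function.Bundles using (_⇔_)
open import Function.Definitions using (Injective; Surjective; Bijective)

-- A signature: Conn k is the set Σ^k of k-ary connectives.
-- Countability of Σ: an injection of the disjoint union of all Σ^k into ℕ.
record Signature : Set₁ where
  field
    Conn      : ℕ → Set
    code      : Σ ℕ Conn → ℕ
    code-inj  : Injective _≡_ _≡_ code

module WithSig (Sg : Signature) where
  open Signature Sg

  data Fm : Set where
    var : ℕ → Fm
    app : ∀ {k} → Conn k → Vec Fm k → Fm

  FmSet : Set₁
  FmSet = Fm → Set

  _∪_ : FmSet → FmSet → FmSet
  (Γ ∪ Δ) φ = Γ φ ⊎ Δ φ

  ∁ : FmSet → FmSet
  ∁ Γ φ = ¬ Γ φ

  Subst : Set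
  Subst = ℕ → Fm

  mutual
    sub : Subst → Fm → Fm
    sub σ (var p)    = σ p
    sub σ (app c φs) = app c (subs σ φs)

    subs : ∀ {k} → Subst → Vec Fm k → Vec Fm k
    subs σ []       = []
    subs σ (φ ∷ φs) = sub σ φ ∷ subs σ φs

  _[_] : Subst → FmSet → FmSet
  (σ [ Γ ]) ψ = ∃ λ φ → Γ φ × sub σ φ ≡ ψ

  Cons : (ℓ : Level) → Set (lsuc lzero ⊔ lsuc ℓ)
  Cons ℓ = FmSet → FmSet → Set ℓ

  record IsLogic {ℓ} (_⊩_ : Cons ℓ) : Set (lsuc lzero ⊔ ℓ) where
    field
      O : ∀ Γ Δ → (∃ λ φ → Γ φ × Δ φ) → Γ ⊩ Δ
      D : ∀ Γ Δ Γ' Δ' → Γ ⊩ Δ → (Γ ∪ Γ') ⊩ (Δ ∪ Δ')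
      C : ∀ Γ Δ → (∀ (Ω : FmSet) → (Γ ∪ Ω) ⊩ (∁ Ω ∪ Δ)) → Γ ⊩ Δ
      S : ∀ Γ Δ (σ : Subst) → Γ ⊩ Δ → (σ [ Γ ]) ⊩ (σ [ Δ ])

  -- Σ-Nmatrices; op c xs y means y ∈ ©(xs)
  record Nmatrix : Set₁ where
    field
      Carrier  : Set
      op       : ∀ {k} → Conn k → Vec Carrier k → Carrier → Set
      nonempty : ∀ {k} (c : Conn k) (xs : Vec Carrier k) → ∃ λ y → op c xs y
      Des      : Carrier → Set

  open Nmatrix

  Class : Set₂
  Class = Nmatrix → Set₁

  record Val (M : Nmatrix) : Set where
    field
      v     : Fm → Carrier M
      resp  : ∀ {k} (c : Conn k) (φs : Vec Fm k) → op M c (map v φs) (v (app c φs))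

  open Val public

  preimage : ∀ {M} → Val M → FmSet
  preimage {M} w φ = Des M (v w φ)

  _⊩[_]_ : FmSet → Nmatrix → FmSet → Set
  Γ ⊩[ M ] Δ = (w : Val M) → (∀ φ → Γ φ → Des M (v w φ)) → ∃ λ φ → Δ φ × Des M (v w φ)

  _⊩⟨_⟩_ : FmSet → Class → FmSet → Set₁
  Γ ⊩⟨ 𝓜 ⟩ Δ = (M : Nmatrix) → 𝓜 M → Γ ⊩[ M ] Δ

  Nmatr : ∀ {ℓ} → Cons ℓ → Nmatrix → Set (lsuc lzero ⊔ ℓ)
  Nmatr _⊩_ M = ∀ Γ Δ → Γ ⊩ Δ → Γ ⊩[ M ] Δ

  FmNmatrix : FmSet → Nmatrix
  FmNmatrix Γ = record
    { Carrier  = Fm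
    ; op       = λ c φs ψ → app c φs ≡ ψ
    ; nonempty = λ c φs → app c φs , refl
    ; Des      = Γ
    }

  𝕃 : ∀ {M} → Val M → Nmatrix
  𝕃 w = FmNmatrix (preimage w)

  -- Γ gives a Lindenbaum matrix of ⊩:  Γ ⊮ Fm ∖ Γ
  IsLindenbaum : ∀ {ℓ} → Cons ℓ → FmSet → Set ℓ
  IsLindenbaum _⊩_ Γ = ¬ (Γ ⊩ ∁ Γ)

  _≐_ : FmSet → FmSet → Set
  Γ ≐ Δ = ∀ φ → Γ φ ⇔ Δ φ

  record IsHom (M₁ M₂ : Nmatrix) (h : Carrier M₁ → Carrier M₂) : Set where
    field
      hom-op  : ∀ {k} (c : Conn k) (xs : Vec (Carrier M₁) k) y →
                op M₁ c xs y → op M₂ c (map h xs) (h y)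
      hom-des : ∀ x → Des M₁ x → Des M₂ (h x)

  record IsStrictHom (M₁ M₂ : Nmatrix) (h : Carrier M₁ → Carrier M₂) : Set where
    field
      isHom  : IsHom M₁ M₂ h
      strict : ∀ x → Des M₂ (h x) → Des M₁ x

  record IsIso (M₁ M₂ : Nmatrix) (h : Carrier M₁ → Carrier M₂) : Set where
    field
      isStrictHom : IsStrictHom M₁ M₂ h
      bij         : Bijective _≡_ _≡_ h
      op-onto     : ∀ {k} (c : Conn k) (xs : Vec (Carrier M₁) k) z →
                    op M₂ c (map h xs) z → ∃ λ y → op M₁ c xs y × h y ≡ z

  _≅_ : Nmatrix → Nmatrix → Set
  M₁ ≅ M₂ = ∃ λ h → IsIso M₁ M₂ h

  -- covering strict hom: strict hom with h[M₁] = M₂, i.e. h[A₁] = A₂,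
  -- ©_h = ©₂ (and then D₂ ∩ h[A₁] = D₂ automatically)
  record IsCovering (M₁ M₂ : Nmatrix) (h : Carrier M₁ → Carrier M₂) : Set where
    field
      isStrictHom : IsStrictHom M₁ M₂ h
      onto        : Surjective _≡_ _≡_ h
      op-cover    : ∀ {k} (c : Conn k) (xs : Vec (Carrier M₂) k) z →
                    op M₂ c xs z →
                    ∃ λ ys → ∃ λ y → map h ys ≡ xs × op M₁ c ys y × h y ≡ z

  -- subNmatrix: A₁ ⊆ A₂ (via an injective inclusion map ι),
  -- ©₁(xs) ⊆ ©₂(xs), and D₁ = D₂ ∩ A₁
  record IsSubNmatrix (M₁ M₂ : Nmatrix) : Set where
    field
      ι       : Carrier M₁ → Carrier M₂
      ι-inj   : Injective _≡_ _≡_ ι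
      ι-op    : ∀ {k} (c : Conn k) (xs : Vec (Carrier M₁) k) y →
                op M₁ c xs y → op M₂ c (map ι xs) (ι y)
      ι-des   : ∀ x → Des M₁ x ⇔ Des M₂ (ι x)

  𝐒 : Class → Class
  𝐒 𝓜 N = Σ Nmatrix λ M → 𝓜 M × Σ Nmatrix λ K → IsSubNmatrix K M × (K ≅ N)

  Hom⁻¹ₛ : Class → Class
  Hom⁻¹ₛ 𝓜 N = Σ Nmatrix λ N' → (N' ≅ N) ×
                 Σ Nmatrix λ M → 𝓜 M × ∃ λ h → IsCovering N' M h

-- A valuation v on a sound Nmatrix designates v⁻¹[D] and nothing outside it, so v⁻¹[D] cannot
-- entail its complement. Conversely (classically) a set Γ with Γ ⊮ Fm∖Γ has a countermodel
-- v in some N ∈ 𝓜 designating exactly Γ. Finally 𝕃_v covers the subNmatrix of N carved out by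
-- the range of v, through v itself.
module Submission where

open import Defs
open import Level using (Level) renaming (zero to lzero; suc to lsuc)
open import Axiom.ExcludedMiddle using (ExcludedMiddle)
open import Axiom.DoubleNegationElimination using (em⇒dne)
open import Data.Bool.Properties using (T-irrelevant)
open import Data.Product using (Σ; ∃; _×_; _,_; proj₁; proj₂)
open import Data.Vec using (Vec; map)
open import Data.Vec.Properties using (map-id; map-∘; map-cong)
open import Function using (_∘_)
open import Function.Bundles using (_⇔_; mk⇔; Equivalence)
open import Function.Construct.Identity using (⇔-id)
open import Relation.Nullary using (¬_)
open import Relation.Nullary.Decidable using (True; toWitness; fromWitness)
open import Relation.Binary.PropositionalEquality using (_≡_; refl; cong; sym; trans; subst)

module _ (Sg : Signature) where
  open WithSig Sg
  open Nmatrix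
  open Equivalence using (to; from)

  ≅-refl : (M : Nmatrix) → M ≅ M
  ≅-refl M = (λ x → x) , record
    { isStrictHom = record
      { isHom  = record
        { hom-op  = λ c xs y → subst (λ ys → op M c ys y) (sym (map-id xs))
        ; hom-des = λ _ d → d }
      ; strict = λ _ d → d }
    ; bij     = (λ e → e) , (λ y → y , λ e → e)
    ; op-onto = λ c xs z o → z , subst (λ ys → op M c ys z) (map-id xs) o , refl }

  preimage-⊮-complement : ∀ {M} (w : Val M) {Γ} → Γ ≐ preimage w → ¬ (Γ ⊩[ M ] ∁ Γ)
  preimage-⊮-complement w Γ≐ Γ⊩∁Γ with Γ⊩∁Γ w (λ φ → to (Γ≐ φ))
  ... | φ , φ∉Γ , φ∈D = φ∉Γ (from (Γ≐ φ) φ∈D)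

  sound⇒preimage-Lindenbaum : ∀ {ℓ} (_⊩_ : Cons ℓ) (M : Nmatrix) → Nmatr _⊩_ M →
                              (w : Val M) → IsLindenbaum _⊩_ (preimage w)
  sound⇒preimage-Lindenbaum _ M sound w =
    preimage-⊮-complement w (λ _ → ⇔-id _) ∘ sound _ _

  preimage⇒class-Lindenbaum : ∀ 𝓜 Γ → (Σ Nmatrix λ N → 𝓜 N × Σ (Val N) λ w → Γ ≐ preimage w) →
                              IsLindenbaum (λ Δ Π → Δ ⊩⟨ 𝓜 ⟩ Π) Γ
  preimage⇒class-Lindenbaum 𝓜 Γ (N , N∈𝓜 , w , Γ≐) Γ⊩∁Γ =
    preimage-⊮-complement w Γ≐ (Γ⊩∁Γ N N∈𝓜)

  module Classical (em₀ : ExcludedMiddle lzero) (em₁ : ExcludedMiddle (lsuc lzero)) where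

    countermodel : ∀ {𝓜 Γ Δ} → ¬ (Γ ⊩⟨ 𝓜 ⟩ Δ) → Σ Nmatrix λ N → 𝓜 N × ¬ (Γ ⊩[ N ] Δ)
    countermodel ⊮ = em⇒dne em₁ λ none → ⊮ λ N N∈𝓜 → em⇒dne em₀ λ ⊮N → none (N , N∈𝓜 , ⊮N)

    countervaluation : ∀ {N Γ Δ} → ¬ (Γ ⊩[ N ] Δ) →
                       Σ (Val N) λ w → (∀ φ → Γ φ → Des N (v w φ))
                                     × ¬ (∃ λ φ → Δ φ × Des N (v w φ))
    countervaluation ⊮ = em⇒dne em₀ λ none → ⊮ λ w Γ⊆ → em⇒dne em₀ λ Δ∩ → none (w , Γ⊆ , Δ∩)

    class-Lindenbaum⇒preimage : ∀ 𝓜 Γ → IsLindenbaum (λ Δ Π → Δ ⊩⟨ 𝓜 ⟩ Π) Γ →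
                                Σ Nmatrix λ N → 𝓜 N × Σ (Val N) λ w → Γ ≐ preimage w
    class-Lindenbaum⇒preimage 𝓜 Γ ⊮ with countermodel ⊮
    ... | N , N∈𝓜 , ⊮N with countervaluation ⊮N
    ...   | w , Γ⊆ , ∁Γ∩D≡∅ =
      N , N∈𝓜 , w , λ φ → mk⇔ (Γ⊆ φ) λ φ∈D → em⇒dne em₀ λ φ∉Γ → ∁Γ∩D≡∅ (φ , φ∉Γ , φ∈D)

    module Range {N : Nmatrix} (w : Val N) where

      InRange : Carrier N → Set
      InRange a = True (em₀ {∃ λ φ → v w φ ≡ a})

      -- InRange is a proposition, so proj₁ embeds the range into the carrier.
      Range : Set
      Range = Σ (Carrier N) InRange

      range-≡ : ∀ {a b : Range} → proj₁ a ≡ proj₁ b → a ≡ b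
      range-≡ {a , p} {.a , q} refl = cong (a ,_) (T-irrelevant p q)

      corestrict : Fm → Range
      corestrict φ = v w φ , fromWitness (φ , refl)

      section : Range → Fm
      section (a , a∈) = proj₁ (toWitness a∈)

      corestrict∘section : ∀ x → corestrict (section x) ≡ x
      corestrict∘section (a , a∈) = range-≡ (proj₂ (toWitness a∈))

      map-corestrict∘section : ∀ {k} (xs : Vec Range k) → map corestrict (map section xs) ≡ xs
      map-corestrict∘section xs =
        trans (sym (map-∘ corestrict section xs)) (trans (map-cong corestrict∘section xs) (map-id xs))

      -- The operations are those of the image of 𝕃 w under corestrict, so that corestrict
      -- covers by construction; they lie inside N's because w is a valuation.
      range : Nmatrix
      range = record
        { Carrier  = Range
        ; op       = λ c xs z → ∃ λ φs → map corestrict φs ≡ xs × corestrict (app c φs) ≡ z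
        ; nonempty = λ c xs → corestrict (app c (map section xs)) ,
                               map section xs , map-corestrict∘section xs , refl
        ; Des      = Des N ∘ proj₁ }

      range-sub : IsSubNmatrix range N
      range-sub = record
        { ι     = proj₁
        ; ι-inj = range-≡
        ; ι-op  = λ { c _ _ (φs , refl , refl) →
                      subst (λ ys → op N c ys (v w (app c φs)))
                            (map-∘ proj₁ corestrict φs) (resp w c φs) }
        ; ι-des = λ x → ⇔-id _ }

      corestrict-covering : IsCovering (𝕃 w) range corestrict
      corestrict-covering = record
        { isStrictHom = record
          { isHom  = record
            { hom-op  = λ c φs ψ app≡ψ → φs , refl , cong corestrict app≡ψ
            ; hom-des = λ _ d → d }
          ; strict = λ _ d → d }
        ; onto        = λ x → section x , λ { refl → corestrict∘section x }
        ; op-cover    = λ c xs z (φs , φs↦xs , app↦z) → φs , app c φs , φs↦xs , refl , app↦z }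

    𝕃-Hom⁻¹ₛ-𝐒 : ∀ 𝓜 (N : Nmatrix) → 𝓜 N → (w : Val N) → Hom⁻¹ₛ (𝐒 𝓜) (𝕃 w)
    𝕃-Hom⁻¹ₛ-𝐒 𝓜 N N∈𝓜 w =
      𝕃 w , ≅-refl (𝕃 w) , range , (N , N∈𝓜 , range , range-sub , ≅-refl range) ,
      corestrict , corestrict-covering
      where open Range w

lemma9 : {ℓ : Level} → ExcludedMiddle lzero → ExcludedMiddle (lsuc lzero) →
         (Sg : Signature) → let open WithSig Sg in
         (∀ (_⊩_ : Cons ℓ) → IsLogic _⊩_ →
            (M : Nmatrix) → Nmatr _⊩_ M → (w : Val M) →
            IsLindenbaum _⊩_ (preimage w))
         × (∀ (𝓜 : Class) →
            (∀ (Γ : FmSet) →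
               IsLindenbaum (λ Δ Π → Δ ⊩⟨ 𝓜 ⟩ Π) Γ
               ⇔ (Σ Nmatrix λ N → 𝓜 N × Σ (Val N) λ w → Γ ≐ preimage w))
            × (∀ (N : Nmatrix) → 𝓜 N → (w : Val N) → Hom⁻¹ₛ (𝐒 𝓜) (𝕃 w)))
lemma9 em₀ em₁ Sg =
  (λ _⊩_ _ → sound⇒preimage-Lindenbaum Sg _⊩_) ,
  λ 𝓜 → (λ Γ → mk⇔ (class-Lindenbaum⇒preimage 𝓜 Γ) (preimage⇒class-Lindenbaum Sg 𝓜 Γ)) ,
        𝕃-Hom⁻¹ₛ-𝐒 𝓜
  where open Classical Sg em₀ em₁
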